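{- Let $G$ be a nontrivial connected graph and let $H$ be a graph without isolated vertices such that $G\circ H$ has a total $[1,2]$-set. Suppose that for every total $[1,2]$-set $D$ of $G\circ H$ there is a vertex $v\in V(G)$ with $|H^v\cap D|=1$ and a vertex $w\in V(G)$ with $|H^w\cap D|=2$, where $H^x=\{(x,h):h\in V(H)\}$. Then for every total $[1,2]$-set $D$ of $G\circ H$: (1) for every $v\in V(G)$ and distinct $u',u''\in V(H)$ with $(v,u'),(v,u'')\in D$ and $|H^v\cap D|=2$, the set $\{u',u''\}$ is a total $[1,2]$-set of $H$; (2) the set $S'=\{v\in V(G): (v,u)\in D\text{ for some }u\}$ is a $1$-dependent $[1,2]$-set of $G$; (3) if $v\in S'$ satisfies $|N_G(v)\cap S'|=0$, then $\mathrm{dist}_G(v,v')\geq 3$ for every $v'\in S'\setminus\{v\}$.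
   Context: All graphs are finite and simple. The lexicographic product $G\circ H$ has vertex set $V(G)\times V(H)$, and $(g,h)$ is adjacent to $(g',h')$ if and only if either $\{g,g'\}\in E(G)$, or $g=g'$ and $\{h,h'\}\in E(H)$. For a graph $X$ with open neighborhoods $N_X(\cdot)$: a set $S$ is a total $[1,2]$-set if every vertex $x$ of $X$ satisfies $1\le|N_X(x)\cap S|\le 2$; a set $S$ is a $[1,2]$-set if every vertex $x\notin S$ satisfies $1\le|N_X(x)\cap S|\le 2$; a $[1,2]$-set $S$ is $1$-dependent if every $x\in S$ satisfies $|N_X(x)\cap S|\le 1$. $\mathrm{dist}_G$ is the distance in $G$. -}

module Defs where

open import Data.Nat using (ℕ; zero; suc; _+_; _*_; _≤_; _<_)
open import Data.Fin using (Fin; zero; suc; _≟_; combine; remQuot)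
open import Data.Bool using (Bool; true; false; _∧_; _∨_; if_then_else_)
open import Data.Product using (_×_; ∃; _,_)
open import Relation.Binary.PropositionalEquality using (_≡_; _≢_)
open import Relation.Nullary using (¬_)
open import Relation.Nullary.Decidable using (⌊_⌋)

Adj : ℕ → Set
Adj n = Fin n → Fin n → Bool

IsSimple : ∀ {n} → Adj n → Set
IsSimple {n} A = (∀ (x y : Fin n) → A x y ≡ A y x) × (∀ (x : Fin n) → A x x ≡ false)

VSet : ℕ → Set
VSet n = Fin n → Bool

count : ∀ {n} → (Fin n → Bool) → ℕ
count {zero} P = 0
count {suc n} P = (if P zero then 1 else 0) + count {n} (λ i → P (suc i))

anyF : ∀ {n} → (Fin n → Bool) → Bool
anyF {zero} P = false
anyF {suc n} P = P zero ∨ anyF {n} (λ i → P (suc i))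

nbrCount : ∀ {n} → Adj n → VSet n → Fin n → ℕ
nbrCount A S x = count (λ y → A x y ∧ S y)

IsTotal12 : ∀ {n} → Adj n → VSet n → Set
IsTotal12 {n} A S = ∀ (x : Fin n) → 1 ≤ nbrCount A S x × nbrCount A S x ≤ 2

Is12 : ∀ {n} → Adj n → VSet n → Set
Is12 {n} A S = ∀ (x : Fin n) → S x ≡ false → 1 ≤ nbrCount A S x × nbrCount A S x ≤ 2

Is1Dep12 : ∀ {n} → Adj n → VSet n → Set
Is1Dep12 {n} A S = Is12 A S × (∀ (x : Fin n) → S x ≡ true → nbrCount A S x ≤ 1)

data Walk {n} (A : Adj n) : ℕ → Fin n → Fin n → Set where
  here : ∀ {x} → Walk A 0 x x
  step : ∀ {k x y z} → A x y ≡ true → Walk A k y z → Walk A (suc k) x z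

Connected : ∀ {n} → Adj n → Set
Connected {n} A = ∀ (x y : Fin n) → ∃ λ k → Walk A k x y

Nontrivial : ℕ → Set
Nontrivial n = 2 ≤ n

NoIsolated : ∀ {n} → Adj n → Set
NoIsolated {n} A = ∀ (x : Fin n) → ∃ λ y → A x y ≡ true

DistGe : ∀ {n} → Adj n → ℕ → Fin n → Fin n → Set
DistGe A d x y = ∀ k → k < d → ¬ Walk A k x y

-- lexicographic product on Fin (n * m); vertex (g,h) is  combine g h
lex : ∀ {n m} → Adj n → Adj m → Adj (n * m)
lex {n} {m} AG AH i j with remQuot {n} m i | remQuot {n} m j
... | g , h | g' , h' = AG g g' ∨ (⌊ g ≟ g' ⌋ ∧ AH h h')

fiberCount : ∀ {n m} → VSet (n * m) → Fin n → ℕ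
fiberCount {n} {m} D v = count {m} (λ h → D (combine v h))

proj : ∀ {n m} → VSet (n * m) → VSet n
proj {n} {m} D v = anyF {m} (λ h → D (combine v h))

pair : ∀ {m} → Fin m → Fin m → VSet m
pair u' u'' h = ⌊ h ≟ u' ⌋ ∨ ⌊ h ≟ u'' ⌋

module Submission where

-- Write D_g = {h : (g,h) ∈ D} for the fibre of a vertex set D of G ∘ H over
-- g ∈ V(G), so that |H^g ∩ D| = |D_g|, and S' for the set of g with D_g ≠ ∅.
-- The proof rests on one counting identity for the lexicographic product:
--
--   |N(g,h) ∩ D| = |N_H(h) ∩ D_g| + Σ_{g' ~ g} |D_{g'}|,          (★)
--
-- since the neighbours of (g,h) are its H-neighbours inside H^g together with
-- all of H^{g'} for the G-neighbours g' of g.  Call the second summand the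
-- outer count of g.  For a total [1,2]-set D both summands of (★) are then
-- controlled: an occupied fibre forces outer count ≤ 1 (H has no isolated
-- vertices), the outer count bounds the S'-neighbours of g, and it is at
-- least the fibre size of each G-neighbour.  Claim (1) follows because a
-- fibre of size 2 has outer count 0 and equals {u', u''}; claim (2) by
-- reading (★) at vertices outside and inside S'; claim (3) because an
-- S'-isolated vertex has a fibre of size ≥ 2, so a common neighbour of it
-- and another vertex of S' would have outer count ≥ 3.

open import Defs
open import Data.Nat using (ℕ; zero; suc; _+_; _*_; _≤_; _<_; z≤n; s≤s; s≤s⁻¹)
open import Data.Nat.Properties
  using (≤-refl; ≤-trans; +-mono-≤; +-monoˡ-≤; +-monoʳ-≤; +-mono-≤-<; m≤m+n; m≤n+m;
         +-assoc; +-comm; +-identityʳ; n≤0⇒n≡0; <⇒≱; ≮⇒≥; +-0-commutativeMonoid)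
open import Data.Fin using (Fin; zero; suc; _≟_; combine; _↑ˡ_; _↑ʳ_)
open import Data.Fin.Properties using (remQuot-combine)
open import Data.Bool using (Bool; true; false; _∧_; _∨_; if_then_else_)
open import Data.Bool.Properties using (∧-conicalˡ; ∧-conicalʳ)
open import Data.Product using (_×_; ∃; _,_; proj₁; proj₂)
open import Data.Empty using (⊥; ⊥-elim)
open import Relation.Binary.PropositionalEquality
open import Relation.Nullary using (¬_; yes; no)
open import Relation.Nullary.Decidable using (⌊_⌋)
open import Algebra.Properties.CommutativeMonoid.Sum +-0-commutativeMonoid
  using (sum; sum-syntax; sum-cong-≗; sum-replicate-zero; ∑-distrib-+)

∑-mono : ∀ {n} (s t : Fin n → ℕ) → (∀ i → s i ≤ t i) → sum s ≤ sum t
∑-mono {zero}  s t s≤t = z≤n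
∑-mono {suc n} s t s≤t =
  +-mono-≤ (s≤t zero) (∑-mono (λ i → s (suc i)) (λ i → t (suc i)) (λ i → s≤t (suc i)))

term≤∑ : ∀ {n} (t : Fin n → ℕ) i → t i ≤ sum t
term≤∑ t zero    = m≤m+n (t zero) _
term≤∑ t (suc i) = ≤-trans (term≤∑ (λ j → t (suc j)) i) (m≤n+m _ (t zero))

two-terms≤∑ : ∀ {n} (t : Fin n → ℕ) i j → i ≢ j → t i + t j ≤ sum t
two-terms≤∑ t zero    zero    0≢0 = ⊥-elim (0≢0 refl)
two-terms≤∑ t zero    (suc j) _   = +-monoʳ-≤ (t zero) (term≤∑ (λ k → t (suc k)) j)
two-terms≤∑ t (suc i) zero    _   =
  subst (_≤ sum t) (+-comm (t zero) (t (suc i))) (+-monoʳ-≤ (t zero) (term≤∑ (λ k → t (suc k)) i))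
two-terms≤∑ t (suc i) (suc j) i≢j =
  ≤-trans (two-terms≤∑ (λ k → t (suc k)) i j (λ i≡j → i≢j (cong suc i≡j))) (m≤n+m _ (t zero))

∑-positive : ∀ {n} (t : Fin n → ℕ) → 1 ≤ sum t → ∃ λ i → 1 ≤ t i
∑-positive {suc n} t pos with t zero in t₀
... | suc _ = zero , subst (1 ≤_) (sym t₀) (s≤s z≤n)
... | zero with ∑-positive (λ i → t (suc i)) pos
...   | i , tᵢ-pos = suc i , tᵢ-pos

∑-zero : ∀ {n} (t : Fin n → ℕ) → (∀ i → t i ≡ 0) → sum t ≡ 0
∑-zero {n} t zeros = trans (sum-cong-≗ zeros) (sum-replicate-zero n)

∑-delta : ∀ {n} (i : Fin n) (c : ℕ) → sum (λ j → if ⌊ i ≟ j ⌋ then c else 0) ≡ c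
∑-delta {suc n} zero c = trans (cong (c +_) (∑-zero {n} (λ _ → 0) (λ _ → refl))) (+-identityʳ c)
∑-delta (suc i) c = trans (sum-cong-≗ shift) (∑-delta i c)
  where
  shift : ∀ j → (if ⌊ suc i ≟ suc j ⌋ then c else 0) ≡ (if ⌊ i ≟ j ⌋ then c else 0)
  shift j with i ≟ j
  ... | yes _ = refl
  ... | no  _ = refl

∑-split : ∀ a b (t : Fin (a + b) → ℕ) →
  sum t ≡ ∑[ i < a ] t (i ↑ˡ b) + ∑[ j < b ] t (a ↑ʳ j)
∑-split zero    b t = refl
∑-split (suc a) b t =
  trans (cong (t zero +_) (∑-split a b (λ i → t (suc i)))) (sym (+-assoc (t zero) _ _))

∑-combine : ∀ n m (t : Fin (n * m) → ℕ) →
  sum t ≡ ∑[ g < n ] ∑[ h < m ] t (combine g h)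
∑-combine zero    m t = refl
∑-combine (suc n) m t =
  trans (∑-split m (n * m) t) (cong (sum (λ h → t (h ↑ˡ (n * m))) +_) (∑-combine n m (λ i → t (m ↑ʳ i))))

indicator : Bool → ℕ
indicator b = if b then 1 else 0

count≡∑ : ∀ {n} (P : Fin n → Bool) → count P ≡ ∑[ i < n ] indicator (P i)
count≡∑ {zero}  P = refl
count≡∑ {suc n} P = cong (indicator (P zero) +_) (count≡∑ (λ i → P (suc i)))

indicator-mono : ∀ a b → (a ≡ true → b ≡ true) → indicator a ≤ indicator b
indicator-mono false b _   = z≤n
indicator-mono true  b a⇒b rewrite a⇒b refl = ≤-refl

count-cong : ∀ {n} (P Q : Fin n → Bool) → (∀ i → P i ≡ Q i) → count P ≡ count Q
count-cong P Q P≗Q = trans (count≡∑ P) (trans (sum-cong-≗ (λ i → cong indicator (P≗Q i))) (sym (count≡∑ Q)))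

count-empty : ∀ n → count {n} (λ _ → false) ≡ 0
count-empty zero    = refl
count-empty (suc n) = count-empty n

count-mono : ∀ {n} (P Q : Fin n → Bool) → (∀ i → P i ≡ true → Q i ≡ true) → count P ≤ count Q
count-mono P Q P⊆Q = subst₂ _≤_ (sym (count≡∑ P)) (sym (count≡∑ Q))
  (∑-mono _ _ (λ i → indicator-mono (P i) (Q i) (P⊆Q i)))

count-witness : ∀ {n} (P : Fin n → Bool) → 1 ≤ count P → ∃ λ i → P i ≡ true
count-witness P pos with ∑-positive _ (subst (1 ≤_) (count≡∑ P) pos)
... | i , Pᵢ-pos = i , lemma (P i) Pᵢ-pos
  where
  lemma : ∀ b → 1 ≤ indicator b → b ≡ true
  lemma true _ = refl

member≤count : ∀ {n} (P : Fin n → Bool) i → P i ≡ true → 1 ≤ count P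
member≤count P i Pᵢ = subst (1 ≤_) (sym (count≡∑ P))
  (subst (λ b → indicator b ≤ sum (λ j → indicator (P j))) Pᵢ (term≤∑ (λ j → indicator (P j)) i))

two-members≤count : ∀ {n} (P : Fin n → Bool) i j → i ≢ j → P i ≡ true → P j ≡ true → 2 ≤ count P
two-members≤count P i j i≢j Pᵢ Pⱼ = subst (2 ≤_) (sym (count≡∑ P))
  (subst₂ (λ a b → indicator a + indicator b ≤ sum (λ k → indicator (P k))) Pᵢ Pⱼ
    (two-terms≤∑ (λ k → indicator (P k)) i j i≢j))

count-mono-< : ∀ {n} (P Q : Fin n → Bool) → (∀ i → P i ≡ true → Q i ≡ true) →
  ∀ i → P i ≡ false → Q i ≡ true → count P < count Q
count-mono-< {suc n} P Q P⊆Q zero P₀ Q₀ rewrite P₀ | Q₀ =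
  s≤s (count-mono (λ i → P (suc i)) (λ i → Q (suc i)) (λ i → P⊆Q (suc i)))
count-mono-< {suc n} P Q P⊆Q (suc i) Pᵢ Qᵢ =
  +-mono-≤-< (indicator-mono (P zero) (Q zero) (P⊆Q zero))
    (count-mono-< (λ i → P (suc i)) (λ i → Q (suc i)) (λ i → P⊆Q (suc i)) i Pᵢ Qᵢ)

subset-of-equal-count : ∀ {n} (P Q : Fin n → Bool) → (∀ i → P i ≡ true → Q i ≡ true) →
  count Q ≤ count P → ∀ i → P i ≡ Q i
subset-of-equal-count P Q P⊆Q Q≤P i with P i in Pᵢ | Q i in Qᵢ
... | true  | true  = refl
... | false | false = refl
... | true  | false = trans (sym (P⊆Q i Pᵢ)) Qᵢ
... | false | true  = ⊥-elim (<⇒≱ (count-mono-< P Q P⊆Q i Pᵢ Qᵢ) Q≤P)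

count-combine : ∀ n m (P : Fin (n * m) → Bool) →
  count P ≡ ∑[ g < n ] count {m} (λ h → P (combine g h))
count-combine n m P = begin
    count P
  ≡⟨ count≡∑ P ⟩
    ∑[ y < n * m ] indicator (P y)
  ≡⟨ ∑-combine n m (λ y → indicator (P y)) ⟩
    ∑[ g < n ] ∑[ h < m ] indicator (P (combine g h))
  ≡⟨ sum-cong-≗ {n} (λ g → sym (count≡∑ (λ h → P (combine g h)))) ⟩
    ∑[ g < n ] count {m} (λ h → P (combine g h))
  ∎
  where open ≡-Reasoning

anyF-witness : ∀ {n} (P : Fin n → Bool) → anyF P ≡ true → ∃ λ i → P i ≡ true
anyF-witness {suc n} P any with P zero in P₀
... | true  = zero , P₀
... | false with anyF-witness (λ i → P (suc i)) any
...   | i , Pᵢ = suc i , Pᵢ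

witness-anyF : ∀ {n} (P : Fin n → Bool) i → P i ≡ true → anyF P ≡ true
witness-anyF P zero    P₀ rewrite P₀ = refl
witness-anyF P (suc i) Pᵢ rewrite witness-anyF (λ j → P (suc j)) i Pᵢ with P zero
... | true  = refl
... | false = refl

pair-left : ∀ {m} (u' u'' : Fin m) → pair u' u'' u' ≡ true
pair-left u' u'' with u' ≟ u'
... | yes _     = refl
... | no  u'≢u' = ⊥-elim (u'≢u' refl)

pair-right : ∀ {m} (u' u'' : Fin m) → pair u' u'' u'' ≡ true
pair-right u' u'' with u'' ≟ u' | u'' ≟ u''
... | yes _ | _           = refl
... | no  _ | yes _       = refl
... | no  _ | no  u''≢u'' = ⊥-elim (u''≢u'' refl)

pair⊆ : ∀ {m} (u' u'' : Fin m) (S : VSet m) → S u' ≡ true → S u'' ≡ true →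
  ∀ y → pair u' u'' y ≡ true → S y ≡ true
pair⊆ u' u'' S Su' Su'' y y∈pair with y ≟ u' | y ≟ u''
... | yes refl | _        = Su'
... | no  _    | yes refl = Su''

fibre : ∀ {n m} → VSet (n * m) → Fin n → VSet m
fibre {n} {m} D g h = D (combine g h)

outerCount : ∀ {n m} → Adj n → VSet (n * m) → Fin n → ℕ
outerCount {n} {m} AG D g = ∑[ g' < n ] (if AG g g' then fiberCount {n} {m} D g' else 0)

lex-combine : ∀ {n m} (AG : Adj n) (AH : Adj m) g h g' h' →
  lex AG AH (combine g h) (combine g' h') ≡ (AG g g' ∨ (⌊ g ≟ g' ⌋ ∧ AH h h'))
lex-combine {n} {m} AG AH g h g' h' =
  cong₂ (λ p q → AG (proj₁ p) (proj₁ q) ∨ (⌊ proj₁ p ≟ proj₁ q ⌋ ∧ AH (proj₂ p) (proj₂ q)))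
    (remQuot-combine {n} {m} g h) (remQuot-combine {n} {m} g' h')

fibre-contribution : ∀ {n m} (AG : Adj n) (AH : Adj m) (D : VSet (n * m)) →
  (∀ g → AG g g ≡ false) → ∀ g h g' →
  count (λ h' → lex AG AH (combine g h) (combine g' h') ∧ D (combine g' h'))
    ≡ (if ⌊ g ≟ g' ⌋ then nbrCount AH (fibre D g) h else 0)
      + (if AG g g' then fiberCount {n} {m} D g' else 0)
fibre-contribution {n} {m} AG AH D irreflexive g h g' =
  trans (count-cong _ _ (λ h' → cong (_∧ D (combine g' h')) (lex-combine AG AH g h g' h'))) by-cases
  where
  by-cases : count (λ h' → (AG g g' ∨ (⌊ g ≟ g' ⌋ ∧ AH h h')) ∧ D (combine g' h'))
    ≡ (if ⌊ g ≟ g' ⌋ then nbrCount AH (fibre D g) h else 0)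
      + (if AG g g' then fiberCount {n} {m} D g' else 0)
  by-cases with g ≟ g'
  ... | yes refl rewrite irreflexive g = sym (+-identityʳ _)
  ... | no  _ with AG g g'
  ...   | true  = refl
  ...   | false = count-empty m

lex-nbrCount : ∀ {n m} (AG : Adj n) (AH : Adj m) (D : VSet (n * m)) →
  (∀ g → AG g g ≡ false) → ∀ g h →
  nbrCount (lex AG AH) D (combine g h) ≡ nbrCount AH (fibre D g) h + outerCount AG D g
lex-nbrCount {n} {m} AG AH D irreflexive g h = begin
    nbrCount (lex AG AH) D (combine g h)
  ≡⟨ count-combine n m (λ y → lex AG AH (combine g h) y ∧ D y) ⟩
    ∑[ g' < n ] count {m} (λ h' → lex AG AH (combine g h) (combine g' h') ∧ D (combine g' h'))
  ≡⟨ sum-cong-≗ {n} (fibre-contribution AG AH D irreflexive g h) ⟩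
    ∑[ g' < n ] ((if ⌊ g ≟ g' ⌋ then inner else 0) + (if AG g g' then fiberCount {n} {m} D g' else 0))
  ≡⟨ ∑-distrib-+ (λ g' → if ⌊ g ≟ g' ⌋ then inner else 0) (λ g' → if AG g g' then fiberCount {n} {m} D g' else 0) ⟩
    ∑[ g' < n ] (if ⌊ g ≟ g' ⌋ then inner else 0) + outerCount AG D g
  ≡⟨ cong (_+ outerCount AG D g) (∑-delta g inner) ⟩
    inner + outerCount AG D g
  ∎
  where
  open ≡-Reasoning
  inner : ℕ
  inner = nbrCount AH (fibre D g) h

module TotalSet {n m} (AG : Adj n) (AH : Adj m) (simpleG : IsSimple AG) (simpleH : IsSimple AH)
                (noIsolated : NoIsolated AH) (D : VSet (n * m)) (total : IsTotal12 (lex AG AH) D) where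

  f : Fin n → ℕ
  f = fiberCount {n} {m} D

  inner : Fin n → Fin m → ℕ
  inner g h = nbrCount AH (fibre D g) h

  outer : Fin n → ℕ
  outer = outerCount AG D

  S' : VSet n
  S' = proj {n} {m} D

  symG : ∀ {x y} → AG x y ≡ true → AG y x ≡ true
  symG {x} {y} xy = trans (proj₁ simpleG y x) xy

  inner+outer : ∀ g h → 1 ≤ inner g h + outer g × inner g h + outer g ≤ 2
  inner+outer g h =
    subst (λ k → 1 ≤ k × k ≤ 2) (lex-nbrCount AG AH D (proj₂ simpleG) g h) (total (combine g h))

  outer≡0⇒inner-total : ∀ g → outer g ≡ 0 → ∀ h → 1 ≤ inner g h × inner g h ≤ 2
  outer≡0⇒inner-total g outer≡0 h =
    subst (λ k → 1 ≤ k × k ≤ 2) (trans (cong (inner g h +_) outer≡0) (+-identityʳ _)) (inner+outer g h)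

  outer≤2 : ∀ g → Fin m → outer g ≤ 2
  outer≤2 g h = ≤-trans (m≤n+m (outer g) (inner g h)) (proj₂ (inner+outer g h))

  inner≤f : ∀ g h → inner g h ≤ f g
  inner≤f g h = count-mono _ _ (λ y → ∧-conicalʳ (AH h y) (D (combine g y)))

  S'⇒occupied : ∀ g → S' g ≡ true → 1 ≤ f g
  S'⇒occupied g g∈S' with anyF-witness (fibre D g) g∈S'
  ... | h , gh∈D = member≤count (fibre D g) h gh∈D

  occupied⇒S' : ∀ g → 1 ≤ f g → S' g ≡ true
  occupied⇒S' g occupied with count-witness (fibre D g) occupied
  ... | h , gh∈D = witness-anyF (fibre D g) h gh∈D

  -- A vertex with a nonempty fibre has outer count at most 1: a vertex of D_g
  -- has an H-neighbour h, and (g,h) already sees it inside H^g.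
  occupied⇒outer≤1 : ∀ g → 1 ≤ f g → outer g ≤ 1
  occupied⇒outer≤1 g occupied with count-witness (fibre D g) occupied
  ... | x , gx∈D with noIsolated x
  ...   | h , xh = s≤s⁻¹ (≤-trans (+-monoˡ-≤ (outer g) inner-pos) (proj₂ (inner+outer g h)))
    where
    inner-pos : 1 ≤ inner g h
    inner-pos = member≤count _ x (cong₂ _∧_ (trans (proj₁ simpleH h x) xh) gx∈D)

  neighbour≤outer : ∀ g g' → AG g g' ≡ true → f g' ≤ outer g
  neighbour≤outer g g' gg' =
    subst (λ b → (if b then f g' else 0) ≤ outer g) gg' (term≤∑ (λ g'' → if AG g g'' then f g'' else 0) g')

  two-neighbours≤outer : ∀ x g g' → g ≢ g' → AG x g ≡ true → AG x g' ≡ true → f g + f g' ≤ outer x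
  two-neighbours≤outer x g g' g≢g' xg xg' =
    subst₂ (λ a b → (if a then f g else 0) + (if b then f g' else 0) ≤ outer x) xg xg'
      (two-terms≤∑ (λ g'' → if AG x g'' then f g'' else 0) g g' g≢g')

  S'-neighbours≤outer : ∀ x → nbrCount AG S' x ≤ outer x
  S'-neighbours≤outer x = subst (_≤ outer x) (sym (count≡∑ (λ g → AG x g ∧ S' g)))
    (∑-mono _ _ (λ g → termwise g (AG x g)))
    where
    termwise : ∀ g b → indicator (b ∧ S' g) ≤ (if b then f g else 0)
    termwise g false = z≤n
    termwise g true with S' g in g∈S'
    ... | false = z≤n
    ... | true  = S'⇒occupied g g∈S'

  outer-witness : ∀ x → 1 ≤ outer x → ∃ λ g → AG x g ≡ true × S' g ≡ true
  outer-witness x pos with ∑-positive (λ g → if AG x g then f g else 0) pos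
  ... | g , term-pos with AG x g in xg
  ...   | true = g , xg , occupied⇒S' g term-pos

  no-S'-neighbour⇒outer≡0 : ∀ x → (∀ g → AG x g ≡ true → S' g ≡ true → ⊥) → outer x ≡ 0
  no-S'-neighbour⇒outer≡0 x none =
    n≤0⇒n≡0 (≮⇒≥ (λ pos → let (g , xg , g∈S') = outer-witness x pos in none g xg g∈S'))

  -- Its neighbours in
  -- S' would have outer count ≥ 2, so its own outer count is 0, and the fibre
  -- coincides with {u', u''} since it has size 2 and contains both.
  fibre-pair-total : ∀ v u' u'' → u' ≢ u'' → D (combine v u') ≡ true → D (combine v u'') ≡ true →
    f v ≡ 2 → IsTotal12 AH (pair u' u'')
  fibre-pair-total v u' u'' u'≢u'' vu' vu'' fv≡2 h =
    subst (λ k → 1 ≤ k × k ≤ 2) (count-cong _ _ (λ y → cong (AH h y ∧_) (fibre≡pair y)))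
      (outer≡0⇒inner-total v outer≡0 h)
    where
    big-neighbour : ∀ g → AG v g ≡ true → S' g ≡ true → ⊥
    big-neighbour g vg g∈S' = <⇒≱ (s≤s (s≤s z≤n))
      (≤-trans (subst (_≤ outer g) fv≡2 (neighbour≤outer g v (symG vg)))
               (occupied⇒outer≤1 g (S'⇒occupied g g∈S')))
    outer≡0 : outer v ≡ 0
    outer≡0 = no-S'-neighbour⇒outer≡0 v big-neighbour
    fibre≡pair : ∀ y → fibre D v y ≡ pair u' u'' y
    fibre≡pair y = sym (subset-of-equal-count (pair u' u'') (fibre D v) (pair⊆ u' u'' (fibre D v) vu' vu'')
      (subst (_≤ count (pair u' u'')) (sym fv≡2)
        (two-members≤count (pair u' u'') u' u'' u'≢u'' (pair-left u' u'') (pair-right u' u''))) y)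

  -- Claim (2): S' is a 1-dependent [1,2]-set of G (given some vertex of H).
  -- Outside S' the fibre is empty, so (★) bounds the S'-neighbours by 1 and 2;
  -- inside S' the outer count is at most 1.
  S'-1-dependent : Fin m → Is1Dep12 AG S'
  S'-1-dependent h = dominated , dependent
    where
    dominated : Is12 AG S'
    dominated x x∉S' = lower , ≤-trans (S'-neighbours≤outer x) (outer≤2 x h)
      where
      empty : inner x h ≡ 0
      empty = n≤0⇒n≡0 (≤-trans (inner≤f x h) (≮⇒≥ unoccupied))
        where
        unoccupied : ¬ (1 ≤ f x)
        unoccupied occupied with trans (sym x∉S') (occupied⇒S' x occupied)
        ... | ()
      inner+outer≡outer : inner x h + outer x ≡ outer x
      inner+outer≡outer = cong (_+ outer x) empty
      lower : 1 ≤ nbrCount AG S' x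
      lower with outer-witness x (subst (1 ≤_) inner+outer≡outer (proj₁ (inner+outer x h)))
      ... | g , xg , g∈S' = member≤count (λ g → AG x g ∧ S' g) g (cong₂ _∧_ xg g∈S')
    dependent : ∀ x → S' x ≡ true → nbrCount AG S' x ≤ 1
    dependent x x∈S' = ≤-trans (S'-neighbours≤outer x) (occupied⇒outer≤1 x (S'⇒occupied x x∈S'))

  -- Its outer count is 0, so a vertex of D_v has an
  -- H-neighbour in D_v and |D_v| ≥ 2; a common G-neighbour x of v and another
  -- vertex v' of S' then has outer count at least 3, contradicting outer≤2.
  isolated-far : ∀ v → S' v ≡ true → nbrCount AG S' v ≡ 0 →
    ∀ v' → S' v' ≡ true → v' ≢ v → DistGe AG 3 v v'
  isolated-far v v∈S' isolated v' v'∈S' v'≢v k k<3 walk = short-walk walk v'∈S' v'≢v k<3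
    where
    no-S'-neighbour : ∀ g → AG v g ≡ true → S' g ≡ true → ⊥
    no-S'-neighbour g vg g∈S' =
      <⇒≱ (s≤s z≤n) (subst (1 ≤_) isolated (member≤count (λ g → AG v g ∧ S' g) g (cong₂ _∧_ vg g∈S')))
    fibre-vertex : ∃ λ x → D (combine v x) ≡ true
    fibre-vertex = count-witness (fibre D v) (S'⇒occupied v v∈S')
    big-fibre : 2 ≤ f v
    big-fibre with fibre-vertex
    ... | x , vx with count-witness _ (proj₁ (outer≡0⇒inner-total v (no-S'-neighbour⇒outer≡0 v no-S'-neighbour) x))
    ...   | y , xy∧vy = two-members≤count (fibre D v) x y x≢y vx (∧-conicalʳ (AH x y) _ xy∧vy)
      where
      x≢y : x ≢ y
      x≢y refl with trans (sym (proj₂ simpleH x)) (∧-conicalˡ (AH x x) _ xy∧vy)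
      ... | ()
    short-walk : ∀ {k w} → Walk AG k v w → S' w ≡ true → w ≢ v → k < 3 → ⊥
    short-walk here _ w≢v _ = w≢v refl
    short-walk (step vw here) w∈S' _ _ = no-S'-neighbour _ vw w∈S'
    short-walk {w = w} (step {y = x} vx (step xw here)) w∈S' w≢v _ = <⇒≱ three≤outer (outer≤2 x (proj₁ fibre-vertex))
      where
      three≤outer : 3 ≤ outer x
      three≤outer = ≤-trans (+-mono-≤ big-fibre (S'⇒occupied w w∈S'))
        (two-neighbours≤outer x v w (λ v≡w → w≢v (sym v≡w)) (symG vx) xw)
    short-walk (step _ (step _ (step _ _))) _ _ (s≤s (s≤s (s≤s ())))

-- Lemma 4.7.
lemma4p7 : ∀ {n m} (AG : Adj n) (AH : Adj m) →
    IsSimple AG → IsSimple AH →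
    Nontrivial n → Connected AG → NoIsolated AH →
    (∃ λ (D : VSet (n * m)) → IsTotal12 (lex AG AH) D) →
    (∀ (D : VSet (n * m)) → IsTotal12 (lex AG AH) D →
      (∃ λ v → fiberCount {n} {m} D v ≡ 1) × (∃ λ w → fiberCount {n} {m} D w ≡ 2)) →
    ∀ (D : VSet (n * m)) → IsTotal12 (lex AG AH) D →
      (∀ (v : Fin n) (u' u'' : Fin m) → u' ≢ u'' →
        D (combine v u') ≡ true → D (combine v u'') ≡ true →
        fiberCount {n} {m} D v ≡ 2 → IsTotal12 AH (pair u' u''))
      × Is1Dep12 AG (proj {n} {m} D)
      × (∀ (v : Fin n) → proj {n} {m} D v ≡ true →
          nbrCount AG (proj {n} {m} D) v ≡ 0 →
          ∀ (v' : Fin n) → proj {n} {m} D v' ≡ true → v' ≢ v → DistGe AG 3 v v')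
lemma4p7 {m = m} AG AH simpleG simpleH _ _ noIsolated _ fibre-sizes D total =
  fibre-pair-total , S'-1-dependent some-vertex , isolated-far
  where
  open TotalSet AG AH simpleG simpleH noIsolated D total
  some-vertex : Fin m
  some-vertex with proj₁ (fibre-sizes D total)
  ... | v , fv≡1 = proj₁ (count-witness (fibre D v) (subst (1 ≤_) (sym fv≡1) ≤-refl))
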